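{- For integers $k,r\geq 3$ and $c\in\mathbb N$, the $k$-graph $Z^{(k)}_{cr}$ is a subgraph of (i.e. there is a copy of it in) the blow-up $Z^{(k)}_r(c)$.
   Context: For integers $\ell\geq 2$, the zycle $Z^{(k)}_\ell$ is the $k$-graph with vertex set $\{v_i^j: i\in[\ell], j\in[k-1]\}$ and edge set $\{\{v_i^1,\dots,v_i^{k-1},v_{i+1}^j\}: i\in[\ell], j\in[k-1]\}$, indices $i$ modulo $\ell$. For a $k$-graph $F$ on vertex set $\{1,\dots,f\}$ and $c\in\mathbb N$, the $c$-blow-up $F(c)$ is the $k$-graph with vertex set $V_1\dot\cup\cdots\dot\cup V_f$, $|V_i|=c$, whose edges are all $k$-sets $\{u_1,\dots,u_k\}$ with $u_j\in V_{i_j}$ for $j\in[k]$ where $\{i_1,\dots,i_k\}\in E(F)$. -}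

module Defs where

open import Data.Nat using (ℕ; zero; suc; _∸_; _<?_)
open import Data.Fin using (Fin; zero; suc; toℕ; fromℕ<)
open import Data.Product using (Σ; ∃; _×_; _,_)
open import Data.Sum using (_⊎_)
open import Relation.Nullary using (yes; no)
open import Relation.Binary.PropositionalEquality using (_≡_)
open import Function.Definitions using (Injective)
open import Function.Bundles using (_⇔_)

record Hypergraph : Set₁ where
  field
    V   : Set
    E   : Set
    mem : E → V → Set
open Hypergraph public

next : ∀ {n} → Fin n → Fin n
next {suc n} i with suc (toℕ i) <? suc n
... | yes p = fromℕ< p
... | no _  = zero

-- The zycle Z^(k)_ℓ: vertices v_i^j (i ∈ [ℓ], j ∈ [k-1]) encoded as (i , j);
-- edge (i , j) = {v_i^1,…,v_i^{k-1}, v_{i+1}^j}.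
Zycle : (k ℓ : ℕ) → Hypergraph
Zycle k ℓ = record
  { V   = Fin ℓ × Fin (k ∸ 1)
  ; E   = Fin ℓ × Fin (k ∸ 1)
  ; mem = λ { (i , j) (i' , j') → (i' ≡ i) ⊎ ((i' ≡ next i) × (j' ≡ j)) }
  }

-- The c-blow-up F(c): vertex (x , a) is the a-th vertex of the part V_x.
-- Edges are the sets {u_1,…,u_k} with u_j ∈ V_{i_j} for an edge {i_1,…,i_k}
-- of F, i.e. one vertex chosen (via g) in each part V_x with x in the edge e.
BlowUp : Hypergraph → ℕ → Hypergraph
BlowUp F c = record
  { V   = V F × Fin c
  ; E   = E F × (V F → Fin c)
  ; mem = λ { (e , g) (x , a) → mem F e x × (a ≡ g x) }
  }

IsSubgraph : Hypergraph → Hypergraph → Set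
IsSubgraph H G =
  Σ (V H → V G) λ φ →
    Injective _≡_ _≡_ φ ×
    ((e : E H) → ∃ λ (e' : E G) →
       (w : V G) → mem G e' w ⇔ (∃ λ (v : V H) → mem H e v × (φ v ≡ w)))

{-# OPTIONS --safe #-}
module Submission where

-- Wrap Z_{cr} c times around Z_r: send v_i^j to copy ⌊i/r⌋ of v_{i mod r}^j. The edge of
-- Z_{cr} at i lies in blocks i mod r and (i+1) mod r, which differ because r ≥ 2, so it is the
-- blow-up edge over the edge of Z_r at i mod r that picks copy ⌊i/r⌋ in the first block and
-- copy ⌊(i+1)/r⌋ in the second.

open import Defs
open import Data.Nat using (ℕ; _≤_; _*_)
open import Data.Nat using (suc; _+_; _<?_; NonZero; >-nonZero)
open import Data.Nat.Properties using (≤-trans; ≤-antisym; ≮⇒≥; n≤1+n; 1+n≢n; +-comm; *-comm)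
open import Data.Nat.DivMod using (_%_; _/_; m<n⇒m%n≡m; n%n≡0; [m+kn]%n≡m%n; m≡m%n+[m/n]*n; m∣n⇒o%n%m≡o%m)
open import Data.Nat.Divisibility using (n∣m*n)
open import Data.Fin using (Fin; toℕ; combine; quotient; remainder; _≟_)
open import Data.Fin.Properties using (toℕ-fromℕ<; toℕ-injective; toℕ<n; combine-remQuot; toℕ-combine; nonZeroIndex)
open import Data.Product using (∃; _×_; _,_; proj₁; proj₂)
open import Data.Sum using (inj₁; inj₂)
open import Relation.Nullary using (yes; no; contradiction)
open import Relation.Binary.PropositionalEquality
open import Function.Bundles using (_⇔_; mk⇔)

toℕ-next : ∀ {n} .{{_ : NonZero n}} (i : Fin n) → toℕ (next i) ≡ suc (toℕ i) % n
toℕ-next {suc n} i with suc (toℕ i) <? suc n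
... | yes i+1<n = trans (toℕ-fromℕ< i+1<n) (sym (m<n⇒m%n≡m i+1<n))
... | no i+1≮n = begin
  0                  ≡⟨ sym (n%n≡0 (suc n)) ⟩
  suc n % suc n      ≡⟨ cong (_% suc n) (≤-antisym (≮⇒≥ i+1≮n) (toℕ<n i)) ⟩
  suc (toℕ i) % suc n ∎
  where open ≡-Reasoning

next-≢ : ∀ {n} → 2 ≤ n → (i : Fin n) → next i ≢ i
next-≢ {suc n} 2≤n i eq with suc (toℕ i) <? suc n
... | yes i+1<n = 1+n≢n (trans (sym (toℕ-fromℕ< i+1<n)) (cong toℕ eq))
... | no i+1≮n with refl ← eq = i+1≮n 2≤n

toℕ-remainder : ∀ {m} n .{{_ : NonZero n}} (i : Fin (m * n)) →
                toℕ (remainder {m} n i) ≡ toℕ i % n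
toℕ-remainder {m} n i = sym (begin
  toℕ i % n                                 ≡⟨ cong (λ x → toℕ x % n) (sym (combine-remQuot {m} n i)) ⟩
  toℕ (combine q s) % n                     ≡⟨ cong (_% n) (toℕ-combine q s) ⟩
  (n * toℕ q + toℕ s) % n                   ≡⟨ cong (_% n) (+-comm (n * toℕ q) (toℕ s)) ⟩
  (toℕ s + n * toℕ q) % n                   ≡⟨ cong (λ x → (toℕ s + x) % n) (*-comm n (toℕ q)) ⟩
  (toℕ s + toℕ q * n) % n                   ≡⟨ [m+kn]%n≡m%n (toℕ s) (toℕ q) n ⟩
  toℕ s % n                                 ≡⟨ m<n⇒m%n≡m (toℕ<n s) ⟩
  toℕ s                                     ∎)
  where
  open ≡-Reasoning
  q = quotient {m} n i
  s = remainder {m} n i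

suc-% : ∀ m n .{{_ : NonZero n}} → suc m % n ≡ suc (m % n) % n
suc-% m n = begin
  suc m % n                     ≡⟨ cong (λ x → suc x % n) (m≡m%n+[m/n]*n m n) ⟩
  suc (m % n + (m / n) * n) % n ≡⟨ [m+kn]%n≡m%n (suc (m % n)) (m / n) n ⟩
  suc (m % n) % n               ∎
  where open ≡-Reasoning

remainder-next : ∀ {m} n .{{_ : NonZero n}} (i : Fin (m * n)) →
                 remainder {m} n (next i) ≡ next (remainder {m} n i)
remainder-next {m} n i = toℕ-injective (begin
  toℕ (remainder {m} n (next i))     ≡⟨ toℕ-remainder {m} n (next i) ⟩
  toℕ (next i) % n                   ≡⟨ cong (_% n) (toℕ-next i) ⟩
  suc (toℕ i) % (m * n) % n          ≡⟨ m∣n⇒o%n%m≡o%m n (m * n) (suc (toℕ i)) (n∣m*n m) ⟩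
  suc (toℕ i) % n                    ≡⟨ suc-% (toℕ i) n ⟩
  suc (toℕ i % n) % n                ≡⟨ cong (λ x → suc x % n) (sym (toℕ-remainder {m} n i)) ⟩
  suc (toℕ (remainder {m} n i)) % n  ≡⟨ sym (toℕ-next (remainder {m} n i)) ⟩
  toℕ (next (remainder {m} n i))     ∎)
  where
  open ≡-Reasoning
  instance
    m*n≢0 : NonZero (m * n)
    m*n≢0 = nonZeroIndex i

remQuot-injective : ∀ {m} n {i j : Fin (m * n)} →
                    (quotient {m} n i , remainder {m} n i) ≡ (quotient {m} n j , remainder {m} n j) →
                    i ≡ j
remQuot-injective {m} n {i} {j} eq =
  trans (sym (combine-remQuot {m} n i)) (trans (cong (λ p → combine (proj₁ p) (proj₂ p)) eq) (combine-remQuot {m} n j))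

module ZycleInBlowUp (k r c : ℕ) .{{_ : NonZero r}} (2≤r : 2 ≤ r) where

  Z = Zycle k (c * r)
  B = BlowUp (Zycle k r) c

  rem : Fin (c * r) → Fin r
  rem = remainder {c} r

  quo : Fin (c * r) → Fin c
  quo = quotient {c} r

  φ : V Z → V B
  φ (i , j) = (rem i , j) , quo i

  φ-injective : ∀ {u v} → φ u ≡ φ v → u ≡ v
  φ-injective eq =
    cong₂ _,_ (remQuot-injective {c} r (cong₂ _,_ (cong proj₂ eq) (cong (λ w → proj₁ (proj₁ w)) eq)))
              (cong (λ w → proj₂ (proj₁ w)) eq)

  choice : Fin (c * r) → V (Zycle k r) → Fin c
  choice i (x , _) with x ≟ rem i
  ... | yes _ = quo i
  ... | no _  = quo (next i)

  choice-rem : ∀ i j → choice i (rem i , j) ≡ quo i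
  choice-rem i j with rem i ≟ rem i
  ... | yes _   = refl
  ... | no ≢rem = contradiction refl ≢rem

  choice-next-rem : ∀ i j → choice i (next (rem i) , j) ≡ quo (next i)
  choice-next-rem i j with next (rem i) ≟ rem i
  ... | yes eq = contradiction eq (next-≢ 2≤r (rem i))
  ... | no _   = refl

  choice-rem-next : ∀ i j → choice i (rem (next i) , j) ≡ quo (next i)
  choice-rem-next i j = trans (cong (λ x → choice i (x , j)) (remainder-next {c} r i)) (choice-next-rem i j)

  ψ : E Z → E B
  ψ (i , j) = (rem i , j) , choice i

  ψ-image : ∀ e (w : V B) → mem B (ψ e) w ⇔ ∃ λ v → mem Z e v × φ v ≡ w
  ψ-image (i , j) w = mk⇔ (to w) (from w)
    where
    to : ∀ w → mem B (ψ (i , j)) w → ∃ λ v → mem Z (i , j) v × φ v ≡ w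
    to ((_ , j′) , _) (inj₁ refl , refl) =
      (i , j′) , inj₁ refl , cong (_ ,_) (sym (choice-rem i j′))
    to _ (inj₂ (refl , refl) , refl) =
      (next i , j) , inj₂ (refl , refl) ,
      cong₂ _,_ (cong (_, j) (remainder-next {c} r i))
                (sym (choice-next-rem i j))
    from : ∀ w → (∃ λ v → mem Z (i , j) v × φ v ≡ w) → mem B (ψ (i , j)) w
    from _ ((_ , j′) , inj₁ refl , refl) = inj₁ refl , sym (choice-rem i j′)
    from _ (_ , inj₂ (refl , refl) , refl) =
      inj₂ (remainder-next {c} r i , refl) , sym (choice-rem-next i j)

  embedding : IsSubgraph Z B
  embedding = φ , φ-injective , λ e → ψ e , ψ-image e

fact2p3 : (k r c : ℕ) → 3 ≤ k → 3 ≤ r →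
          IsSubgraph (Zycle k (c * r)) (BlowUp (Zycle k r) c)
fact2p3 k r c _ 3≤r = ZycleInBlowUp.embedding k r c {{r≢0}} 2≤r
  where
  2≤r : 2 ≤ r
  2≤r = ≤-trans (n≤1+n 2) 3≤r
  r≢0 : NonZero r
  r≢0 = >-nonZero (≤-trans (n≤1+n 1) 2≤r)
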